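{- Let $s,t,n\in\mathbb{N}$ with $s\geq t\geq 2$ and $n\geq 2s+t-1$, and let $\mathcal{F}'=\mathcal{F}_1\cup\mathcal{F}_2\cup\mathcal{F}_3\cup\mathcal{F}_4\subseteq 2^{[n]}$ be as described in the context. If $F_1,\dots,F_s\in\mathcal{F}'$ are pairwise incomparable (with respect to inclusion), then \[ \left|\bigcap_{i=1}^{s}\left(F_i\cap[s+t-1]\right)\right|<t. \]
   Context: For integers $m\le k$, $[m,k]=\{m,m+1,\dots,k\}$ and $[k]=[1,k]$; complements are taken in $[n]$, so $\{x\}^c=[n]\setminus\{x\}$; $\binom{A}{k}$ is the family of $k$-element subsets of $A$. For $A\subseteq B\subseteq[n]$, a chain from $A$ to $B$ is a family of sets listable as $A=C_0\subsetneq C_1\subsetneq\dots\subsetneq C_r=B$; it is complete if it has exactly $|B\setminus A|+1$ members; two chains from $A$ to $B$ are internally disjoint if their intersection is $\{A,B\}$. If $\mathcal{L}$ is the union (as a family of sets) of $k$ pairwise internally disjoint complete chains from $A$ to $B$ with $|B\setminus A|\ge k$, let $X_1,\dots,X_k$ be its $k$ distinct members of size $|A|+1$ and $Y_1,\dots,Y_k$ its $k$ distinct members of size $|B|-1$; the first increment set of $\mathcal{L}$ is $\bigcup_{i=1}^k X_i\setminus A$ and the last increment set is $B\setminus\bigcap_{i=1}^k Y_i$. For $A\subseteq[s+t]$: an upper $s$-lantern $\mathcal{L}^s(A)$ is a union of $s-1$ pairwise internally disjoint complete chains from $A$ to $A\cup[s+t+1,n]$ whose last increment set is $[s+t+1,2s+t-1]$;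 a lower $t$-lantern $\mathcal{L}_t(A)$ is a union of $t-1$ pairwise internally disjoint complete chains from $A$ to $A\cup[s+t+1,n]$ whose first increment set is $[s+t+1,s+2t-1]$. For each relevant $A$ one such lantern is fixed. Define $\mathcal{F}_1=\{[n]\}\cup\{\{x\}^c: x\in[s+t-1]\}$; $\mathcal{F}_2=\bigcup_{A\in\binom{[s+t-1]}{t}}\mathcal{L}^s(A)$; $\mathcal{F}_3=\bigcup_{A\in\binom{[s+t-1]}{t-1}}\mathcal{L}_t(A\cup\{s+t\})$; $\mathcal{F}_4=\{\emptyset\}\cup\{\{x\}:x\in[s+t-1]\}$; and $\mathcal{F}'=\mathcal{F}_1\cup\mathcal{F}_2\cup\mathcal{F}_3\cup\mathcal{F}_4$. -}

module Defs where

open import Data.Nat using (ℕ; zero; suc; _≤ᵇ_; _≡ᵇ_; _∸_; _+_)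
open import Data.Bool using (Bool; true; false; _∧_; T)
open import Data.Fin using (Fin; toℕ; inject₁; fromℕ)
open import Data.Fin.Subset using (Subset; _∈_; _∉_; _⊆_; _⊂_; _∪_; _∩_; _─_; ∣_∣; ⊤; ⊥; ⁅_⁆; ∁)
open import Data.Fin.Subset.Properties using (_⊆?_)
open import Data.Vec using (tabulate)
open import Data.Product using (Σ; ∃; ∃-syntax; _×_)
open import Data.Sum using (_⊎_)
open import Relation.Binary.PropositionalEquality using (_≡_; _≢_)
open import Relation.Nullary.Decidable using (⌊_⌋)

-- Convention: the ground set [n] = {1,…,n} is represented by Fin n,
-- the element x ∈ [n] being the index i : Fin n with toℕ i + 1 = x.
-- Subsets of [n] are Subset n (from Data.Fin.Subset).

interval : (n a b : ℕ) → Subset n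
interval n a b = tabulate λ i → (a ≤ᵇ suc (toℕ i)) ∧ (suc (toℕ i) ≤ᵇ b)

record CompleteChain (n : ℕ) (A B : Subset n) : Set where
  field
    member  : Fin (suc ∣ B ─ A ∣) → Subset n
    start   : member Fin.zero ≡ A
    end     : member (fromℕ ∣ B ─ A ∣) ≡ B
    strict  : (i : Fin ∣ B ─ A ∣) → member (inject₁ i) ⊂ member (Fin.suc i)

record Lantern (n k : ℕ) (A B : Subset n) : Set where
  field
    chain    : Fin k → CompleteChain n A B
    disjoint : (i j : Fin k) → i ≢ j →
               (p q : Fin (suc ∣ B ─ A ∣)) →
               CompleteChain.member (chain i) p ≡ CompleteChain.member (chain j) q →
               (CompleteChain.member (chain i) p ≡ A) ⊎ (CompleteChain.member (chain i) p ≡ B)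

_∈L_ : ∀ {n k} {A B : Subset n} → Subset n → Lantern n k A B → Set
F ∈L L = ∃[ i ] ∃[ p ] (CompleteChain.member (Lantern.chain L i) p ≡ F)

InFirstIncrement : ∀ {n k} {A B : Subset n} → Lantern n k A B → Fin n → Set
InFirstIncrement {A = A} L x =
  (∃[ F ] (F ∈L L × ∣ F ∣ ≡ suc ∣ A ∣ × x ∈ F)) × x ∉ A

InLastIncrement : ∀ {n k} {A B : Subset n} → Lantern n k A B → Fin n → Set
InLastIncrement {B = B} L x =
  x ∈ B × ∃[ F ] (F ∈L L × suc ∣ F ∣ ≡ ∣ B ∣ × x ∉ F)

tailSet : (n s t : ℕ) → Subset n
tailSet n s t = interval n (suc (s + t)) n

UpperLantern : (n s t : ℕ) → Subset n → Set
UpperLantern n s t A =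
  Σ (Lantern n (s ∸ 1) A (A ∪ tailSet n s t)) λ L →
    (∀ x → InLastIncrement L x → x ∈ interval n (suc (s + t)) (s + s + t ∸ 1))
    × (∀ x → x ∈ interval n (suc (s + t)) (s + s + t ∸ 1) → InLastIncrement L x)

LowerLantern : (n s t : ℕ) → Subset n → Set
LowerLantern n s t A =
  Σ (Lantern n (t ∸ 1) A (A ∪ tailSet n s t)) λ L →
    (∀ x → InFirstIncrement L x → x ∈ interval n (suc (s + t)) (s + t + t ∸ 1))
    × (∀ x → x ∈ interval n (suc (s + t)) (s + t + t ∸ 1) → InFirstIncrement L x)

base : (n s t : ℕ) → Subset n
base n s t = interval n 1 (s + t ∸ 1)

-- A ∈ binom([s+t-1], k), as a boolean (so the index proof is definitionally unique)
isIndex : (n s t k : ℕ) → Subset n → Bool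
isIndex n s t k A = ⌊ A ⊆? base n s t ⌋ ∧ (∣ A ∣ ≡ᵇ k)

elemSet : (n m : ℕ) → Subset n
elemSet n m = interval n m m

UpperChoice : (n s t : ℕ) → Set
UpperChoice n s t = (A : Subset n) → T (isIndex n s t t A) → UpperLantern n s t A

LowerChoice : (n s t : ℕ) → Set
LowerChoice n s t = (A : Subset n) → T (isIndex n s t (t ∸ 1) A) →
                    LowerLantern n s t (A ∪ elemSet n (s + t))

InF' : ∀ {n s t} → UpperChoice n s t → LowerChoice n s t → Subset n → Set
InF' {n} {s} {t} U Lo F =
  (F ≡ ⊤ ⊎ ∃[ x ] (x ∈ base n s t × F ≡ ∁ ⁅ x ⁆))
  ⊎ (∃[ A ] Σ (T (isIndex n s t t A)) λ h → F ∈L Data.Product.proj₁ (U A h))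
  ⊎ (∃[ A ] Σ (T (isIndex n s t (t ∸ 1) A)) λ h → F ∈L Data.Product.proj₁ (Lo A h))
  ⊎ (F ≡ ⊥ ⊎ ∃[ x ] (x ∈ base n s t × F ≡ ⁅ x ⁆))

module Submission where

-- Let C = ⋂ (Fᵢ ∩ [s+t-1]) and suppose |C| ≥ t. Every Fᵢ contains C, which rules out [n] (it would
-- contain the other Fⱼ), the sets of F₄, and the members of lower lanterns (they meet [s+t-1] in a
-- (t-1)-set). A member of an upper lantern L^s(A) meets [s+t-1] inside A with |A| = t, forcing A = C;
-- then a coatom {x}ᶜ either misses a point of C or contains that member, so all Fᵢ lie in the single
-- lantern L^s(C), a union of s-1 chains, which cannot hold an antichain of size s. Otherwise all Fᵢ
-- are coatoms {xᵢ}ᶜ with distinct xᵢ ∈ [s+t-1] ∖ C, so s + |C| ≤ s+t-1.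

open import Defs
open import Data.Nat using (ℕ; _≤_; _<_; _+_; _∸_)
open import Data.Fin using (Fin)
open import Data.Fin.Subset using (Subset; _⊆_; _∩_; ⋂; ∣_∣)
open import Data.List using (map; allFin)
open import Relation.Binary.PropositionalEquality using (_≢_)
open import Relation.Nullary using (¬_)

open import Data.Nat using (zero; suc; z≤n; s≤s; _≤ᵇ_)
open import Data.Nat.Properties
  using (≤-refl; ≤-trans; ≤-total; ≤ᵇ⇒≤; ≡ᵇ⇒≡; m∸n≤m; m≤n+m; +-monoʳ-≤; ≰⇒>; ≮⇒≥; <⇒≱)
open import Data.Bool using (T; _∧_)
open import Data.Bool.Properties using (T-∧; T-≡; T-irrelevant)
open import Data.Fin using (toℕ; inject₁; fromℕ; fromℕ<) renaming (zero to fzero; suc to fsuc)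
open import Data.Fin.Properties using (pigeonhole; suc-injective; ≤fromℕ; <⇒≢; _≟_)
open import Data.Fin.Subset using (_∈_; _∉_; _∪_; _─_; _-_; ⊤; ⁅_⁆; ∁)
open import Data.Fin.Subset.Properties
  using (⊆-trans; ⊆-refl; ⊆-reflexive; ⊆-antisym; p⊆q⇒∣p∣≤∣q∣; p⊂q⇒∣p∣<∣q∣; ∈⊤; x∈⁅x⁆;
         ∣⁅x⁆∣≡1; ∣⊥∣≡0; x∈∁p⇒x∉p; x∉p⇒x∈∁p; x∈⁅y⁆⇒x≡y; x∈p∪q⁻; p∩q⊆p; p∩q⊆q;
         x∈p∧x≢y⇒x∈p-y; x∈p⇒∣p-x∣<∣p∣; _∈?_)
open import Data.Vec.Properties using ([]=⇒lookup; lookup∘tabulate)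
open import Data.List using (List; _∷_)
open import Data.List.Relation.Unary.Any using (here; there)
import Data.List.Membership.Propositional as List
open import Data.List.Membership.Propositional.Properties using (∈-map⁺; ∈-allFin)
open import Data.Product using (Σ; ∃; ∃-syntax; _×_; _,_; proj₁; proj₂)
open import Data.Sum using (_⊎_; inj₁; inj₂)
open import Data.Empty using (⊥-elim) renaming (⊥ to Empty)
open import Relation.Binary.PropositionalEquality using (_≡_; refl; sym; trans; subst; subst₂; cong)
open import Relation.Nullary using (yes; no)
open import Function.Bundles using (Equivalence)

m∸1<m : ∀ {m} → 1 ≤ m → m ∸ 1 < m
m∸1<m (s≤s _) = ≤-refl

all⊎any : ∀ {m} {P Q : Fin m → Set} → (∀ i → P i ⊎ Q i) → (∀ i → P i) ⊎ ∃ Q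
all⊎any {zero} _ = inj₁ λ ()
all⊎any {suc m} P⊎Q with P⊎Q fzero | all⊎any (λ i → P⊎Q (fsuc i))
... | inj₂ q | _ = inj₂ (fzero , q)
... | inj₁ _ | inj₂ (i , q) = inj₂ (fsuc i , q)
... | inj₁ p | inj₁ ps = inj₁ λ { fzero → p ; (fsuc i) → ps i }

other-index : ∀ {m} → 2 ≤ m → (i : Fin m) → ∃ λ j → j ≢ i
other-index (s≤s (s≤s _)) fzero    = fsuc fzero , λ ()
other-index (s≤s (s≤s _)) (fsuc i) = fzero , λ ()

x∈interval⇒bounds : ∀ {n a b} {x : Fin n} → x ∈ interval n a b →
                    a ≤ suc (toℕ x) × suc (toℕ x) ≤ b
x∈interval⇒bounds {n} {a} {b} {x} x∈ =
  let a≤x , x≤b = Equivalence.to T-∧ x-selected in ≤ᵇ⇒≤ a _ a≤x , ≤ᵇ⇒≤ _ b x≤b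
  where
  x-selected : T ((a ≤ᵇ suc (toℕ x)) ∧ (suc (toℕ x) ≤ᵇ b))
  x-selected = Equivalence.from T-≡ (trans (sym (lookup∘tabulate _ x)) ([]=⇒lookup x∈))

interval-disjoint : ∀ {n a b c d} {x : Fin n} → b < c →
                    x ∈ interval n a b → x ∉ interval n c d
interval-disjoint {n} {a} {b} {c} {d} b<c x∈ab x∈cd =
  <⇒≱ b<c (≤-trans c≤x x≤b)
  where
  c≤x : c ≤ suc (toℕ _)
  c≤x = proj₁ (x∈interval⇒bounds {n} {c} {d} x∈cd)
  x≤b : suc (toℕ _) ≤ b
  x≤b = proj₂ (x∈interval⇒bounds {n} {a} {b} x∈ab)

∣interval1∣≤ : ∀ n b → ∣ interval n 1 b ∣ ≤ b
∣interval1∣≤ zero    b       = z≤n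
∣interval1∣≤ (suc n) zero    = ∣interval1∣≤ n zero
∣interval1∣≤ (suc n) (suc b) = s≤s (∣interval1∣≤ n b)

⋂-lowerBound : ∀ {n} (ps : List (Subset n)) {p} → p List.∈ ps → ⋂ ps ⊆ p
⋂-lowerBound (p ∷ ps) (here refl) = p∩q⊆p p (⋂ ps)
⋂-lowerBound (p ∷ ps) (there p∈ps) = ⊆-trans (p∩q⊆q p (⋂ ps)) (⋂-lowerBound ps p∈ps)

⊆∪⇒⊆ : ∀ {n} {p q r : Subset n} → p ⊆ q ∪ r → (∀ {x} → x ∈ p → x ∉ r) → p ⊆ q
⊆∪⇒⊆ {q = q} {r} p⊆q∪r p∩r≡∅ {x} x∈p with x∈p∪q⁻ q r (p⊆q∪r x∈p)
... | inj₁ x∈q = x∈q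
... | inj₂ x∈r = ⊥-elim (p∩r≡∅ x∈p x∈r)

p⊆q∧∣q∣≤∣p∣⇒p≡q : ∀ {n} {p q : Subset n} → p ⊆ q → ∣ q ∣ ≤ ∣ p ∣ → p ≡ q
p⊆q∧∣q∣≤∣p∣⇒p≡q {p = p} {q} p⊆q ∣q∣≤∣p∣ = ⊆-antisym p⊆q q⊆p
  where
  q⊆p : q ⊆ p
  q⊆p {x} x∈q with x ∈? p
  ... | yes x∈p = x∈p
  ... | no  x∉p = ⊥-elim (<⇒≱ (p⊂q⇒∣p∣<∣q∣ (p⊆q , x , x∈q , x∉p)) ∣q∣≤∣p∣)

injective⇒m+∣r∣≤∣q∣ : ∀ m {n} (f : Fin m → Fin n) → (∀ {i j} → f i ≡ f j → i ≡ j) →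
                      (q r : Subset n) → (∀ i → f i ∈ q) → (∀ i → f i ∉ r) → r ⊆ q →
                      m + ∣ r ∣ ≤ ∣ q ∣
injective⇒m+∣r∣≤∣q∣ zero    f f-inj q r f∈q f∉r r⊆q = p⊆q⇒∣p∣≤∣q∣ r⊆q
injective⇒m+∣r∣≤∣q∣ (suc m) f f-inj q r f∈q f∉r r⊆q =
  ≤-trans (s≤s m+∣r∣≤∣q-f0∣) (x∈p⇒∣p-x∣<∣p∣ (f∈q fzero))
  where
  fsuc≢fzero : ∀ {i : Fin m} → fsuc i ≢ fzero
  fsuc≢fzero ()

  m+∣r∣≤∣q-f0∣ : m + ∣ r ∣ ≤ ∣ q - f fzero ∣
  m+∣r∣≤∣q-f0∣ =
    injective⇒m+∣r∣≤∣q∣ m (λ i → f (fsuc i)) (λ e → suc-injective (f-inj e)) (q - f fzero) r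
      (λ i → x∈p∧x≢y⇒x∈p-y (f∈q (fsuc i)) (λ e → fsuc≢fzero (f-inj e)))
      (λ i → f∉r (fsuc i))
      (λ x∈r → x∈p∧x≢y⇒x∈p-y (r⊆q x∈r) λ { refl → f∉r fzero x∈r })

stepwise-⊆⇒monotone : ∀ {n} d (f : Fin (suc d) → Subset n) → (∀ i → f (inject₁ i) ⊆ f (fsuc i)) →
                      ∀ p q → toℕ p ≤ toℕ q → f p ⊆ f q
stepwise-⊆⇒monotone zero    f step fzero    fzero    _ = ⊆-refl
stepwise-⊆⇒monotone (suc d) f step fzero    fzero    _ = ⊆-refl
stepwise-⊆⇒monotone (suc d) f step fzero    (fsuc q) _ =
  ⊆-trans (step fzero) (stepwise-⊆⇒monotone d (λ i → f (fsuc i)) (λ i → step (fsuc i)) fzero q z≤n)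
stepwise-⊆⇒monotone (suc d) f step (fsuc p) (fsuc q) (s≤s p≤q) =
  stepwise-⊆⇒monotone d (λ i → f (fsuc i)) (λ i → step (fsuc i)) p q p≤q

module _ {n} {A B : Subset n} (C : CompleteChain n A B) where
  open CompleteChain C

  private
    monotone : ∀ p q → toℕ p ≤ toℕ q → member p ⊆ member q
    monotone = stepwise-⊆⇒monotone ∣ B ─ A ∣ member (λ i → proj₁ (strict i))

  member⊆end : ∀ p → member p ⊆ B
  member⊆end p = subst (member p ⊆_) end (monotone p (fromℕ _) (≤fromℕ p))

  members-comparable : ∀ p q → member p ⊆ member q ⊎ member q ⊆ member p
  members-comparable p q with ≤-total (toℕ p) (toℕ q)
  ... | inj₁ p≤q = inj₁ (monotone p q p≤q)
  ... | inj₂ q≤p = inj₂ (monotone q p q≤p)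

module _ {n k} {A B : Subset n} (L : Lantern n k A B) where
  open Lantern L

  ∈L⇒⊆top : ∀ {G} → G ∈L L → G ⊆ B
  ∈L⇒⊆top (c , p , refl) = member⊆end (chain c) p

  antichain-∈L⇒≤ : ∀ {m} (G : Fin m → Subset n) → (∀ i → G i ∈L L) →
                   (∀ i j → i ≢ j → ¬ G i ⊆ G j) → m ≤ k
  antichain-∈L⇒≤ G G∈L antichain =
    ≮⇒≥ λ k<m → two-on-one-chain (pigeonhole k<m (λ i → proj₁ (G∈L i)))
    where
    two-on-one-chain : (∃ λ i → ∃ λ j → (i Data.Fin.< j) × proj₁ (G∈L i) ≡ proj₁ (G∈L j)) → Empty
    two-on-one-chain (i , j , i<j , same-chain) with G∈L i | G∈L j
    ... | c , p , Gi | c′ , q , Gj with same-chain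
    ... | refl with members-comparable (chain c) p q
    ...   | inj₁ Gi⊆Gj = antichain i j (<⇒≢ i<j) (subst₂ _⊆_ Gi Gj Gi⊆Gj)
    ...   | inj₂ Gj⊆Gi = antichain j i (λ j≡i → <⇒≢ i<j (sym j≡i)) (subst₂ _⊆_ Gj Gi Gj⊆Gi)

module _ {n s t : ℕ} {x : Fin n} (x∈base : x ∈ base n s t) where

  base∌tail : x ∉ tailSet n s t
  base∌tail =
    interval-disjoint {a = 1} {c = suc (s + t)} {d = n} (s≤s (m∸n≤m (s + t) 1)) x∈base

  base∌s+t : 1 ≤ s + t → x ∉ elemSet n (s + t)
  base∌s+t 1≤s+t = interval-disjoint {a = 1} {c = s + t} {d = s + t} (m∸1<m 1≤s+t) x∈base

∣index∣≡ : ∀ n s t k A → T (isIndex n s t k A) → ∣ A ∣ ≡ k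
∣index∣≡ n s t k A index = ≡ᵇ⇒≡ _ _ (proj₂ (Equivalence.to T-∧ index))

module _ (s t n : ℕ) (2≤t : 2 ≤ t) (t≤s : t ≤ s)
         (U : UpperChoice n s t) (Lo : LowerChoice n s t)
         (F : Fin s → Subset n) (F∈F′ : ∀ i → InF' {n} {s} {t} U Lo (F i))
         (incomparable : ∀ i j → i ≢ j → ¬ F i ⊆ F j) where

  core : Subset n
  core = ⋂ (map (λ i → F i ∩ base n s t) (allFin s))

  core⊆F∩base : ∀ j → core ⊆ F j ∩ base n s t
  core⊆F∩base j = ⋂-lowerBound _ (∈-map⁺ (λ i → F i ∩ base n s t) (∈-allFin j))

  core⊆F : ∀ j → core ⊆ F j
  core⊆F j = ⊆-trans (core⊆F∩base j) (p∩q⊆p (F j) (base n s t))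

  1≤t : 1 ≤ t
  1≤t = ≤-trans (s≤s z≤n) 2≤t

  2≤s : 2 ≤ s
  2≤s = ≤-trans 2≤t t≤s

  1≤s : 1 ≤ s
  1≤s = ≤-trans 1≤t t≤s

  core⊆base : core ⊆ base n s t
  core⊆base = ⊆-trans (core⊆F∩base j) (p∩q⊆q (F j) (base n s t))
    where
    j : Fin s
    j = fromℕ< 2≤s

  core∌tail : ∀ {x} → x ∈ core → x ∉ tailSet n s t
  core∌tail x∈core = base∌tail {s = s} (core⊆base x∈core)

  F≢⊤ : ∀ j → F j ≢ ⊤
  F≢⊤ j Fj≡⊤ with other-index 2≤s j
  ... | k , k≢j = incomparable k j k≢j (λ {x} _ → subst (x ∈_) (sym Fj≡⊤) ∈⊤)

  Coatom : Subset n → Set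
  Coatom G = ∃[ x ] x ∈ base n s t × G ≡ ∁ ⁅ x ⁆

  UpperMember : Subset n → Set
  UpperMember G = ∃[ A ] Σ (T (isIndex n s t t A)) λ index → G ∈L proj₁ (U A index)

  coatom∉core : ∀ {j x} → F j ≡ ∁ ⁅ x ⁆ → x ∉ core
  coatom∉core {j} {x} Fj≡∁x x∈core = x∈∁p⇒x∉p (subst (x ∈_) Fj≡∁x (core⊆F j x∈core)) (x∈⁅x⁆ x)

  ∈U-cong : ∀ {G A A′} → A ≡ A′ →
            (index : T (isIndex n s t t A)) (index′ : T (isIndex n s t t A′)) →
            G ∈L proj₁ (U A index) → G ∈L proj₁ (U A′ index′)
  ∈U-cong refl index index′ = subst (λ i → _ ∈L proj₁ (U _ i)) (T-irrelevant index index′)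

  module _ (t≤∣core∣ : t ≤ ∣ core ∣) where

    core⊈small : ∀ {P} → core ⊆ P → ∣ P ∣ < t → Empty
    core⊈small core⊆P ∣P∣<t = <⇒≱ ∣P∣<t (≤-trans t≤∣core∣ (p⊆q⇒∣p∣≤∣q∣ core⊆P))

    shape : ∀ j → Coatom (F j) ⊎ UpperMember (F j)
    shape j with F∈F′ j
    ... | inj₁ (inj₁ Fj≡⊤) = ⊥-elim (F≢⊤ j Fj≡⊤)
    ... | inj₁ (inj₂ coatom) = inj₁ coatom
    ... | inj₂ (inj₁ upper) = inj₂ upper
    ... | inj₂ (inj₂ (inj₁ (A , index , F∈Lo))) = ⊥-elim (core⊈small core⊆A ∣A∣<t)
      where
      core⊆A : core ⊆ A
      core⊆A = ⊆∪⇒⊆ (⊆∪⇒⊆ (⊆-trans (core⊆F j) (∈L⇒⊆top (proj₁ (Lo A index)) F∈Lo)) core∌tail)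
                     (λ x∈core → base∌s+t {s = s} (core⊆base x∈core) (≤-trans 1≤t (m≤n+m t s)))
      ∣A∣<t : ∣ A ∣ < t
      ∣A∣<t = subst (_< t) (sym (∣index∣≡ n s t (t ∸ 1) A index)) (m∸1<m 1≤t)
    ... | inj₂ (inj₂ (inj₂ (inj₁ Fj≡∅))) =
      ⊥-elim (core⊈small (subst (core ⊆_) Fj≡∅ (core⊆F j))
                         (subst (_< t) (sym (∣⊥∣≡0 n)) 1≤t))
    ... | inj₂ (inj₂ (inj₂ (inj₂ (x , _ , Fj≡⁅x⁆)))) =
      ⊥-elim (core⊈small (subst (core ⊆_) Fj≡⁅x⁆ (core⊆F j))
                         (subst (_< t) (sym (∣⁅x⁆∣≡1 x)) 2≤t))

    upper⇒core≡ : ∀ {j A} (index : T (isIndex n s t t A)) → F j ∈L proj₁ (U A index) → core ≡ A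
    upper⇒core≡ {j} {A} index Fj∈U =
      p⊆q∧∣q∣≤∣p∣⇒p≡q core⊆A (subst (_≤ ∣ core ∣) (sym (∣index∣≡ n s t t A index)) t≤∣core∣)
      where
      core⊆A : core ⊆ A
      core⊆A = ⊆∪⇒⊆ (⊆-trans (core⊆F j) (∈L⇒⊆top (proj₁ (U A index)) Fj∈U)) core∌tail

    no-upper : ∀ j → ¬ UpperMember (F j)
    no-upper j₀ (A , index , Fj₀∈L) = <⇒≱ (m∸1<m 1≤s) (antichain-∈L⇒≤ L F F∈L incomparable)
      where
      L : Lantern n (s ∸ 1) A (A ∪ tailSet n s t)
      L = proj₁ (U A index)

      core≡A : core ≡ A
      core≡A = upper⇒core≡ index Fj₀∈L

      coatom⇒⊇Fj₀ : ∀ {k x} → x ∈ base n s t → F k ≡ ∁ ⁅ x ⁆ → F j₀ ⊆ F k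
      coatom⇒⊇Fj₀ {k} {x} x∈base Fk≡∁x {y} y∈Fj₀ = subst (y ∈_) (sym Fk≡∁x) (x∉p⇒x∈∁p y∉⁅x⁆)
        where
        x∉A∪tail : x ∉ A ∪ tailSet n s t
        x∉A∪tail x∈ with x∈p∪q⁻ A (tailSet n s t) x∈
        ... | inj₁ x∈A = coatom∉core Fk≡∁x (subst (x ∈_) (sym core≡A) x∈A)
        ... | inj₂ x∈tail = base∌tail {s = s} x∈base x∈tail
        y∉⁅x⁆ : y ∉ ⁅ x ⁆
        y∉⁅x⁆ y∈⁅x⁆ =
          x∉A∪tail (subst (_∈ A ∪ tailSet n s t) (x∈⁅y⁆⇒x≡y x y∈⁅x⁆) (∈L⇒⊆top L Fj₀∈L y∈Fj₀))

      F∈L : ∀ k → F k ∈L L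
      F∈L k with k ≟ j₀
      ... | yes refl = Fj₀∈L
      ... | no k≢j₀ with shape k
      ...   | inj₁ (x , x∈base , Fk≡∁x) =
        ⊥-elim (incomparable j₀ k (λ j₀≡k → k≢j₀ (sym j₀≡k)) (coatom⇒⊇Fj₀ x∈base Fk≡∁x))
      ...   | inj₂ (A′ , index′ , Fk∈L′) =
        ∈U-cong (trans (sym (upper⇒core≡ index′ Fk∈L′)) core≡A) index′ index Fk∈L′

    not-all-coatoms : ¬ (∀ j → Coatom (F j))
    not-all-coatoms coatom =
      <⇒≱ (m∸1<m (≤-trans 1≤t (m≤n+m t s)))
          (≤-trans (+-monoʳ-≤ s t≤∣core∣) (≤-trans s+∣core∣≤∣base∣ (∣interval1∣≤ n (s + t ∸ 1))))
      where
      x : Fin s → Fin n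
      x j = proj₁ (coatom j)

      x-injective : ∀ {i j} → x i ≡ x j → i ≡ j
      x-injective {i} {j} xi≡xj with i ≟ j
      ... | yes i≡j = i≡j
      ... | no  i≢j = ⊥-elim (incomparable i j i≢j (⊆-reflexive Fi≡Fj))
        where
        Fi≡Fj : F i ≡ F j
        Fi≡Fj = trans (proj₂ (proj₂ (coatom i)))
                      (trans (cong (λ z → ∁ ⁅ z ⁆) xi≡xj) (sym (proj₂ (proj₂ (coatom j)))))

      s+∣core∣≤∣base∣ : s + ∣ core ∣ ≤ ∣ base n s t ∣
      s+∣core∣≤∣base∣ =
        injective⇒m+∣r∣≤∣q∣ s x x-injective (base n s t) core
          (λ j → proj₁ (proj₂ (coatom j))) (λ j → coatom∉core (proj₂ (proj₂ (coatom j)))) core⊆base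

    large-core-impossible : Empty
    large-core-impossible with all⊎any shape
    ... | inj₁ all-coatoms = not-all-coatoms all-coatoms
    ... | inj₂ (j , upper) = no-upper j upper

lemma1 : (s t n : ℕ) → 2 ≤ t → t ≤ s → s + s + t ∸ 1 ≤ n →
    (U : UpperChoice n s t) (Lo : LowerChoice n s t) →
    (F : Fin s → Subset n) → (∀ i → InF' {n} {s} {t} U Lo (F i)) →
    (∀ i j → i ≢ j → ¬ (F i ⊆ F j)) →
    ∣ ⋂ (map (λ i → F i ∩ base n s t) (allFin s)) ∣ < t
lemma1 s t n 2≤t t≤s _ U Lo F F∈F′ incomparable =
  ≰⇒> (large-core-impossible s t n 2≤t t≤s U Lo F F∈F′ incomparable)
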